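{- $\mathtt{Trellis}\subseteq\mathtt{incl}\text{ - }\mathtt{ESO}\text{ - }\mathtt{HORN}$: every language accepted by a trellis automaton (equivalently, by a real-time one-way cellular automaton) is defined by an inclusion Horn formula.
   Context: Word structures: for a finite alphabet $\Sigma$ and a nonempty word $w=w_1\dots w_n\in\Sigma^n$, let $\langle w\rangle=([1,n];(Q_s)_{s\in\Sigma},\mathtt{min},\mathtt{max},\mathtt{suc},\mathtt{pred})$ with $Q_s(i)\iff w_i=s$, $\mathtt{min}(i)\iff i=1$, $\mathtt{max}(i)\iff i=n$, $\mathtt{suc}(i)=i+1$ for $i<n$, $\mathtt{suc}(n)=n$, $\mathtt{pred}(i)=i-1$ for $i>1$, $\mathtt{pred}(1)=1$. For $a\in\mathbb{Z}$, $x+a$ denotes $\mathtt{suc}^a(x)$ if $a\ge0$ and $\mathtt{pred}^{ -a}(x)$ if $a<0$; $x-b$ denotes $x+(-b)$. A formula $\Phi$ defines $\{w\in\Sigma^+:\langle w\rangle\models\Phi\}$. Inclusion Horn formulas ($\mathtt{incl}\text{ - }\mathtt{ESO}\text{ - }\mathtt{HORN}$): $\Phi=\exists\mathbf{R}\,\forall x\forall y\,\psi(x,y)$ with $\mathbf{R}$ a finite set of binary predicate symbols and $\psi$ a finite conjunction of Horn clauses $x\le y\wedge\delta_1\wedge\dots\wedge\delta_r\to\delta_0$, where $\delta_0$ is $R(x,y)$ ($R\in\mathbf{R}$) or $\bot$, and each $\delta_i$ ($i\ge1$) is one of: $U(x+a)$, $\neg U(x+a)$, $U(y+a)$, $\neg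 U(y+a)$ ($U\in\{(Q_s)_{s\in\Sigma},\mathtt{min},\mathtt{max}\}$, $a\in\mathbb{Z}$); $x=y$ or $x<y$; $S(x+a,y-b)\wedge x+a\le y-b$ ($S\in\mathbf{R}$, $a,b\ge0$). Trellis automata: $(Q,\Sigma,Q_{accept},\delta)$ with finite $Q\supseteq\Sigma$, $Q_{accept}\subseteq Q$, $\delta:Q^2\to Q$; it assigns to each subword $w_x\dots w_y$ of the input a state: $w_x$ if $x=y$, and $\delta(q_l,q_r)$ if $x<y$, where $q_l,q_r$ are the states assigned to $w_x\dots w_{y-1}$ and $w_{x+1}\dots w_y$; $w$ is accepted iff the state assigned to $w$ is in $Q_{accept}$. $\mathtt{Trellis}$ is the class of languages accepted by trellis automata; equivalently by one-way cellular automata (neighborhood $\{ -1,0\}$, parallel input, output on the last cell) in real time $n$. -}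

module Defs where

open import Data.Nat using (ℕ; zero; suc)
open import Data.Integer using (ℤ; +_; -[1+_]; -_)
open import Data.Fin using (Fin; zero; suc; inject₁; fromℕ; toℕ)
import Data.Fin as F
open import Data.Vec using (Vec; []; _∷_; lookup)
open import Data.List using (List)
open import Data.List.Relation.Unary.All using (All)
open import Data.Bool using (Bool; true)
open import Data.Maybe using (Maybe; just; nothing)
open import Data.Product using (Σ; _×_)
open import Data.Empty using (⊥)
open import Relation.Binary.PropositionalEquality using (_≡_)
open import Function.Definitions using (Injective)

-- Alphabet Σ = Fin m; nonempty words of length suc n are Vec (Fin m) (suc n);
-- positions [1, suc n] are represented by Fin (suc n) (position 1 = zero).

-- saturating successor / predecessor on positions
sucP : ∀ {n} → Fin (suc n) → Fin (suc n)
sucP {zero} zero = zero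
sucP {suc n} zero = suc zero
sucP {suc n} (suc i) = suc (sucP i)

predP : ∀ {n} → Fin (suc n) → Fin (suc n)
predP zero = zero
predP {suc n} (suc i) = inject₁ i

iter : ∀ {A : Set} → ℕ → (A → A) → A → A
iter zero f a = a
iter (suc k) f a = f (iter k f a)

_⊕_ : ∀ {n} → Fin (suc n) → ℤ → Fin (suc n)
x ⊕ (+ k) = iter k sucP x
x ⊕ -[1+ k ] = iter (suc k) predP x

data Var : Set where
  vx vy : Var

data UPred (m : ℕ) : Set where
  Q   : Fin m → UPred m
  min : UPred m
  max : UPred m

data Atom (m r : ℕ) : Set where
  pos  : UPred m → Var → ℤ → Atom m r
  neg  : UPred m → Var → ℤ → Atom m r
  eqxy : Atom m r
  ltxy : Atom m r
  rel  : Fin r → ℕ → ℕ → Atom m r              -- S(x+a, y-b) ∧ x+a ≤ y-b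

-- Horn clause  x ≤ y ∧ δ_1 ∧ … ∧ δ_k → δ_0 ; head nothing = ⊥, just R = R(x,y)
record Clause (m r : ℕ) : Set where
  constructor _⇒_
  field
    body : List (Atom m r)
    head : Maybe (Fin r)

-- Φ = ∃𝐑 ∀x∀y ψ(x,y), 𝐑 = Fin r binary symbols, ψ a finite conjunction
record InclHorn (m : ℕ) : Set where
  field
    r       : ℕ
    clauses : List (Clause m r)

module _ {m n : ℕ} (w : Vec (Fin m) (suc n)) where

  ⟦_⟧U : UPred m → Fin (suc n) → Set
  ⟦ Q s ⟧U i = lookup w i ≡ s
  ⟦ min ⟧U i = i ≡ zero
  ⟦ max ⟧U i = i ≡ fromℕ n

  Assignment : ℕ → Set
  Assignment r = Fin r → Fin (suc n) → Fin (suc n) → Bool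

  val : Var → Fin (suc n) → Fin (suc n) → Fin (suc n)
  val vx x y = x
  val vy x y = y

  ⟦_⟧A : ∀ {r} → Atom m r → Assignment r → Fin (suc n) → Fin (suc n) → Set
  ⟦ pos U v a ⟧A ρ x y = ⟦ U ⟧U (val v x y ⊕ a)
  ⟦ neg U v a ⟧A ρ x y = ⟦ U ⟧U (val v x y ⊕ a) → ⊥
  ⟦ eqxy ⟧A ρ x y = x ≡ y
  ⟦ ltxy ⟧A ρ x y = x F.< y
  ⟦ rel S a b ⟧A ρ x y =
    (ρ S (x ⊕ (+ a)) (y ⊕ (- (+ b))) ≡ true)
      × (x ⊕ (+ a)) F.≤ (y ⊕ (- (+ b)))

  ⟦_⟧H : ∀ {r} → Maybe (Fin r) → Assignment r → Fin (suc n) → Fin (suc n) → Set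
  ⟦ nothing ⟧H ρ x y = ⊥
  ⟦ just R ⟧H ρ x y = ρ R x y ≡ true

  ⟦_⟧C : ∀ {r} → Clause m r → Assignment r → Fin (suc n) → Fin (suc n) → Set
  ⟦ body ⇒ hd ⟧C ρ x y =
    x F.≤ y → All (λ δ → ⟦ δ ⟧A ρ x y) body → ⟦ hd ⟧H ρ x y

_⊨_ : ∀ {m n} → Vec (Fin m) (suc n) → InclHorn m → Set
w ⊨ Φ = Σ (Assignment w r) λ ρ → ∀ x y → All (λ C → ⟦ w ⟧C C ρ x y) clauses
  where open InclHorn Φ

-- Trellis automata over alphabet Fin m; states Fin q with Σ ⊆ Q via an
-- injective embedding.

record Trellis (m : ℕ) : Set where
  field
    q        : ℕ
    embed    : Fin m → Fin q
    embed-inj : Injective _≡_ _≡_ embed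
    accept   : Fin q → Bool
    δ        : Fin q → Fin q → Fin q

-- letter at ℕ-position i (0-based); only used for i ≤ n
at : ∀ {A : Set} {n} → Vec A (suc n) → ℕ → A
at (a ∷ v) zero = a
at (a ∷ []) (suc i) = a
at (a ∷ b ∷ v) (suc i) = at (b ∷ v) i

-- state assigned to the subword starting at (0-based) i of length ℓ+1
stateOf : ∀ {m n} (A : Trellis m) → Vec (Fin m) (suc n) → ℕ → ℕ → Fin (Trellis.q A)
stateOf A w i zero = Trellis.embed A (at w i)
stateOf A w i (suc ℓ) = Trellis.δ A (stateOf A w i ℓ) (stateOf A w (suc i) ℓ)

Accepts : ∀ {m n} → Trellis m → Vec (Fin m) (suc n) → Set
Accepts {n = n} A w = Trellis.accept A (stateOf A w 0 n) ≡ true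

module Submission where

open import Defs
open import Data.Nat using (ℕ; suc)
open import Data.Fin using (Fin)
open import Data.Vec using (Vec)
open import Data.Product using (Σ)
open import Function.Bundles using (_⇔_)

open import Data.Nat as ℕ using (zero; _+_; _∸_; z≤n; s≤s)
import Data.Nat.Properties as ℕ
open import Data.Fin as F using (toℕ; fromℕ; zero; suc; _≟_)
import Data.Fin.Properties as F
open import Data.Integer using (+_)
open import Data.Vec using (_∷_; lookup)
open import Data.List using (List; _∷_; []; _++_; tabulate; concat)
open import Data.List.Relation.Unary.All using (All; _∷_; [])
import Data.List.Relation.Unary.All.Properties as All
open import Data.Bool using (true; if_then_else_)
open import Data.Maybe using (just; nothing)
open import Data.Product using (_×_; _,_; proj₁; proj₂)
open import Relation.Nullary using (Dec; does; yes)
open import Relation.Nullary.Decidable using (dec-true)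
open import Relation.Binary.PropositionalEquality
open import Function.Bundles using (mk⇔)

-- Interpret the state symbols of the automaton as binary relations: R_q(x, y) is
-- meant to say that the trellis automaton assigns q to the subword w_x … w_y.
-- Horn clauses for the two rules of the trellis (one-letter subwords, and
-- δ applied to the two maximal proper subwords) force every model to contain
-- this intended relation, and the intended relation is itself a model; a clause
-- min(x) ∧ max(y) ∧ R_q(x, y) → ⊥ for each rejecting q then expresses acceptance.

does-true⇒ : ∀ {a} {A : Set a} (a? : Dec A) → does a? ≡ true → A
does-true⇒ (yes a) _ = a

at-toℕ : ∀ {A : Set} {n} (w : Vec A (suc n)) (i : Fin (suc n)) → at w (toℕ i) ≡ lookup w i
at-toℕ (a ∷ v) zero = refl
at-toℕ (a ∷ b ∷ v) (suc i) = at-toℕ (b ∷ v) i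

toℕ-sucP : ∀ {n} (x : Fin (suc n)) → toℕ x ℕ.< n → toℕ (sucP x) ≡ suc (toℕ x)
toℕ-sucP {suc n} zero _ = refl
toℕ-sucP {suc n} (suc i) (s≤s i<n) = cong suc (toℕ-sucP i i<n)

suc-toℕ-predP : ∀ {n} (y : Fin (suc n)) → 0 ℕ.< toℕ y → suc (toℕ (predP y)) ≡ toℕ y
suc-toℕ-predP {suc n} (suc i) _ = cong suc (F.toℕ-inject₁ i)

module _ {n : ℕ} {x y : Fin (suc n)} (x<y : x F.< y) where

  <⇒toℕ-sucP : toℕ (sucP x) ≡ suc (toℕ x)
  <⇒toℕ-sucP = toℕ-sucP x (ℕ.<-≤-trans x<y (ℕ.≤-pred (F.toℕ<n y)))

  <⇒suc-toℕ-predP : suc (toℕ (predP y)) ≡ toℕ y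
  <⇒suc-toℕ-predP = suc-toℕ-predP y (ℕ.≤-<-trans z≤n x<y)

  <⇒sucP≤ : sucP x F.≤ y
  <⇒sucP≤ = subst (ℕ._≤ toℕ y) (sym <⇒toℕ-sucP) x<y

  <⇒≤predP : x F.≤ predP y
  <⇒≤predP = ℕ.≤-pred (subst (toℕ x ℕ.<_) (sym <⇒suc-toℕ-predP) x<y)

module _ {m : ℕ} (A : Trellis m) where
  open Trellis A

  module TrellisState {n : ℕ} (w : Vec (Fin m) (suc n)) where

    state : Fin (suc n) → Fin (suc n) → Fin q
    state x y = stateOf A w (toℕ x) (toℕ y ∸ toℕ x)

    state-refl : ∀ x → state x x ≡ embed (lookup w x)
    state-refl x rewrite ℕ.n∸n≡0 (toℕ x) = cong embed (at-toℕ w x)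

    state-< : ∀ {x y} → x F.< y → state x y ≡ δ (state x (predP y)) (state (sucP x) y)
    state-< {x} {y} x<y
      rewrite <⇒toℕ-sucP x<y | sym (<⇒suc-toℕ-predP x<y) | ℕ.+-∸-assoc 1 (<⇒≤predP x<y) = refl

    state-whole : state zero (fromℕ n) ≡ stateOf A w 0 n
    state-whole = cong (stateOf A w 0) (F.toℕ-fromℕ n)

  letterClause : Fin m → Clause m q
  letterClause s = (eqxy ∷ pos (Q s) vx (+ 0) ∷ []) ⇒ just (embed s)

  stepClause : Fin q → Fin q → Clause m q
  stepClause p p' = (ltxy ∷ rel p 0 1 ∷ rel p' 1 0 ∷ []) ⇒ just (δ p p')

  -- For an accepting q the head is R_q itself, making the clause a tautology.
  acceptanceClause : Fin q → Clause m q
  acceptanceClause s =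
    (pos min vx (+ 0) ∷ pos max vy (+ 0) ∷ rel s 0 0 ∷ []) ⇒
      (if accept s then just s else nothing)

  trellisClauses : List (Clause m q)
  trellisClauses =
    tabulate letterClause ++ concat (tabulate (λ p → tabulate (stepClause p))) ++ tabulate acceptanceClause

  trellisFormula : InclHorn m
  trellisFormula = record { r = q ; clauses = trellisClauses }

  module _ {ℓ} {P : Clause m q → Set ℓ} where

    All-trellisClauses⁺ : (∀ s → P (letterClause s)) → (∀ p p' → P (stepClause p p')) →
      (∀ s → P (acceptanceClause s)) → All P trellisClauses
    All-trellisClauses⁺ letter step final =
      All.++⁺ (All.tabulate⁺ letter)
        (All.++⁺ (All.concat⁺ (All.tabulate⁺ λ p → All.tabulate⁺ (step p))) (All.tabulate⁺ final))

    All-trellisClauses⁻ : All P trellisClauses →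
      (∀ s → P (letterClause s)) × (∀ p p' → P (stepClause p p')) × (∀ s → P (acceptanceClause s))
    All-trellisClauses⁻ all =
      All.tabulate⁻ (All.++⁻ˡ _ all) ,
      (λ p → All.tabulate⁻ (All.tabulate⁻ (All.concat⁻ (All.++⁻ˡ _ rest)) p)) ,
      All.tabulate⁻ (All.++⁻ʳ _ rest)
      where rest = All.++⁻ʳ (tabulate letterClause) all

  module _ {n : ℕ} (w : Vec (Fin m) (suc n)) where
    open TrellisState w

    module _ {ρ : Assignment w q} {s : Fin q} {x y : Fin (suc n)} where

      accept⇒acceptHead : accept s ≡ true → ρ s x y ≡ true →
        ⟦ w ⟧H (Clause.head (acceptanceClause s)) ρ x y
      accept⇒acceptHead accepting ρsxy rewrite accepting = ρsxy

      acceptHead⇒accept : ⟦ w ⟧H (Clause.head (acceptanceClause s)) ρ x y → accept s ≡ true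
      acceptHead⇒accept head with accept s
      ... | true = refl

    intended : Assignment w q
    intended s x y = does (state x y ≟ s)

    intended-sound : Accepts A w → w ⊨ trellisFormula
    intended-sound acc =
      intended , λ x y → All-trellisClauses⁺ (letterHolds x y) (stepHolds x y) (acceptanceHolds x y)
      where
      letterHolds : ∀ x y s → ⟦ w ⟧C (letterClause s) intended x y
      letterHolds x .x s _ (refl ∷ wₓ≡s ∷ []) =
        dec-true (state x x ≟ embed s) (trans (state-refl x) (cong embed wₓ≡s))

      stepHolds : ∀ x y p p' → ⟦ w ⟧C (stepClause p p') intended x y
      stepHolds x y p p' _ (x<y ∷ (left , _) ∷ (right , _) ∷ []) =
        dec-true (state x y ≟ δ p p')
          (trans (state-< x<y) (cong₂ δ (does-true⇒ (_ ≟ p) left) (does-true⇒ (_ ≟ p') right)))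

      acceptanceHolds : ∀ x y s → ⟦ w ⟧C (acceptanceClause s) intended x y
      acceptanceHolds .zero y s _ (refl ∷ refl ∷ (whole , _) ∷ []) =
        accept⇒acceptHead {ρ = intended} (trans (cong accept (sym whole≡s)) acc) whole
        where
        whole≡s : stateOf A w 0 n ≡ s
        whole≡s = trans (sym state-whole) (does-true⇒ (state zero (fromℕ n) ≟ s) whole)

    module _ (ρ : Assignment w q) (models : ∀ x y → All (λ C → ⟦ w ⟧C C ρ x y) trellisClauses) where

      letterHolds : ∀ x y s → ⟦ w ⟧C (letterClause s) ρ x y
      letterHolds x y = proj₁ (All-trellisClauses⁻ (models x y))

      stepHolds : ∀ x y p p' → ⟦ w ⟧C (stepClause p p') ρ x y
      stepHolds x y = proj₁ (proj₂ (All-trellisClauses⁻ (models x y)))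

      acceptanceHolds : ∀ x y s → ⟦ w ⟧C (acceptanceClause s) ρ x y
      acceptanceHolds x y = proj₂ (proj₂ (All-trellisClauses⁻ (models x y)))

      state-forced : ∀ ℓ x y → toℕ y ≡ toℕ x + ℓ → ρ (state x y) x y ≡ true
      state-forced zero x y y≡x+0 with F.toℕ-injective (trans y≡x+0 (ℕ.+-identityʳ (toℕ x)))
      ... | refl = subst (λ s → ρ s x x ≡ true) (sym (state-refl x))
        (letterHolds x x (lookup w x) F.≤-refl (refl ∷ refl ∷ []))
      state-forced (suc ℓ) x y y≡x+1+ℓ = subst (λ s → ρ s x y ≡ true) (sym (state-< x<y))
        (stepHolds x y _ _ (ℕ.<⇒≤ x<y)
          (x<y ∷ (state-forced ℓ x (predP y) predP-y≡x+ℓ , <⇒≤predP x<y)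
               ∷ (state-forced ℓ (sucP x) y y≡sucP-x+ℓ , <⇒sucP≤ x<y) ∷ []))
        where
        y≡1+x+ℓ : toℕ y ≡ suc (toℕ x + ℓ)
        y≡1+x+ℓ = trans y≡x+1+ℓ (ℕ.+-suc (toℕ x) ℓ)
        x<y : x F.< y
        x<y = subst (toℕ x ℕ.<_) (sym y≡1+x+ℓ) (s≤s (ℕ.m≤m+n (toℕ x) ℓ))
        predP-y≡x+ℓ : toℕ (predP y) ≡ toℕ x + ℓ
        predP-y≡x+ℓ = ℕ.suc-injective (trans (<⇒suc-toℕ-predP x<y) y≡1+x+ℓ)
        y≡sucP-x+ℓ : toℕ y ≡ toℕ (sucP x) + ℓ
        y≡sucP-x+ℓ = trans y≡1+x+ℓ (cong (_+ ℓ) (sym (<⇒toℕ-sucP x<y)))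

      models⇒accepts : Accepts A w
      models⇒accepts = acceptHead⇒accept
        (acceptanceHolds zero (fromℕ n) _ z≤n
          (refl ∷ refl ∷ (whole , z≤n) ∷ []))
        where
        whole : ρ (stateOf A w 0 n) zero (fromℕ n) ≡ true
        whole = subst (λ s → ρ s zero (fromℕ n) ≡ true) state-whole
          (state-forced n zero (fromℕ n) (F.toℕ-fromℕ n))

    accepts⇔models : Accepts A w ⇔ (w ⊨ trellisFormula)
    accepts⇔models = mk⇔ intended-sound (λ (ρ , models) → models⇒accepts ρ models)

lemma9 : (m : ℕ) (A : Trellis m) →
    Σ (InclHorn m) λ Φ →
    (n : ℕ) (w : Vec (Fin m) (suc n)) → Accepts A w ⇔ (w ⊨ Φ)
lemma9 m A = trellisFormula A , λ n w → accepts⇔models A w
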